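{- Let $H$ be a strongly connected simple digraph, $k$ a positive integer, and $T$ a tournament that does not contain $k$ pairwise vertex-disjoint topological minor copies of $H$. Then there is a set $S$ of at most $2d_{\mathrm{pw}}\|H\|\cdot k\log k$ vertices of $T$ that is $H$-hitting, i.e., $T-S$ does not contain $H$ as a topological minor.
   Context: For a digraph $H$, $\|H\|:=|V(H)|+|A(H)|$; logarithms are base 2. A tournament is a simple digraph in which every pair of distinct vertices is joined by exactly one arc. A topological minor copy of $H$ is a digraph $\widehat H$ with a mapping sending vertices of $H$ to distinct vertices and arcs $(u,v)$ of $H$ to directed paths between the images, these paths being internally vertex-disjoint, avoiding images of vertices as internal vertices, and covering all arcs and all non-image vertices of $\widehat H$ exactly once; a digraph contains $H$ as a topological minor if it has a subgraph that is a topological minor copy of $H$. An interval decomposition of a tournament $T=(V,A)$ is a map $I$ from $V$ to nonempty closed intervals with integer endpoints such that whenever $\max I(u)<\min I(v)$ we have $(u,v)\in A$; its width is $\max_{\alpha\in\mathbb Z}|\{v:\alpha\in I(v)\}|$, and the pathwidth $\mathrm{pw}(T)$ is the minimum width of an interval decomposition. $d_{\mathrm{pw}}$ is a fixed universal constant such that for every digraph $H'$ and every tournament $T'$ not containing $H'$ as a topological minor, $\mathrm{pw}(T')\le d_{\mathrm{pw}}\|H'\|$ (such a constant exists by a theorem of Fomin and Pilipczuk).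
   Formalization: The constant $d_{\mathrm{pw}}$ is taken to be rational, and the lemma is stated for every rational value of it having the Fomin–Pilipczuk pathwidth property. -}

module Defs where

open import Data.Nat using (ℕ; _+_; _*_; _≤_)
open import Data.Bool using (Bool; true; false; T; if_then_else_)
open import Data.Fin using (Fin)
open import Data.Fin.Subset using (Subset; _∉_)
open import Data.List using (List; []; _∷_; length; filter; allFin; map)
open import Data.Nat.ListAction using (sum)
open import Data.List.Membership.Propositional using (_∈_)
open import Data.List.Relation.Unary.Unique.Propositional using (Unique)
open import Data.Integer as ℤ using (ℤ)
open import Data.Product using (Σ; _×_; ∃; ∃-syntax)
open import Data.Sum using (_⊎_)
open import Relation.Nullary using (¬_)
open import Relation.Nullary.Decidable using (_×-dec_)
open import Relation.Binary.PropositionalEquality using (_≡_; _≢_)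

record Digraph : Set where
  field
    size     : ℕ
    arc      : Fin size → Fin size → Bool
    loopless : ∀ v → arc v v ≡ false
open Digraph public

Arc : (G : Digraph) → Fin (size G) → Fin (size G) → Set
Arc G u v = T (arc G u v)

numArcs : Digraph → ℕ
numArcs G = sum (map (λ u → sum (map (λ v → if arc G u v then 1 else 0)
                                     (allFin (size G))))
                     (allFin (size G)))

‖_‖ : Digraph → ℕ
‖ G ‖ = size G + numArcs G

IsTournament : Digraph → Set
IsTournament G = ∀ u v → u ≢ v →
  (Arc G u v × ¬ Arc G v u) ⊎ (Arc G v u × ¬ Arc G u v)

data Reach (G : Digraph) : Fin (size G) → Fin (size G) → Set where
  here : ∀ {u} → Reach G u u
  step : ∀ {u w v} → Arc G u w → Reach G w v → Reach G u v

StronglyConnected : Digraph → Set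
StronglyConnected G = ∀ u v → Reach G u v

WalkVia : (G : Digraph) → Fin (size G) → List (Fin (size G)) → Fin (size G) → Set
WalkVia G a []       b = Arc G a b
WalkVia G a (x ∷ xs) b = Arc G a x × WalkVia G x xs b

-- A topological minor copy of H inside G: branch vertices φ (injective),
-- for each arc (u,v) of H a directed path φ u → φ v in G given by its list
-- of internal vertices; paths are internally vertex-disjoint and their
-- internal vertices avoid all branch vertices.

record TMCopy (G H : Digraph) : Set where
  field
    φ            : Fin (size H) → Fin (size G)
    φ-inj        : ∀ u v → φ u ≡ φ v → u ≡ v
    path         : ∀ u v → Arc H u v → List (Fin (size G))
    path-walk    : ∀ u v (a : Arc H u v) → WalkVia G (φ u) (path u v a) (φ v)
    path-unique  : ∀ u v (a : Arc H u v) → Unique (path u v a)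
    path-avoid   : ∀ u v (a : Arc H u v) x → x ∈ path u v a → ∀ w → x ≢ φ w
    path-disj    : ∀ u v (a : Arc H u v) u' v' (a' : Arc H u' v') x →
                   x ∈ path u v a → x ∈ path u' v' a' → (u ≡ u' × v ≡ v')
open TMCopy public

Uses : ∀ {G H} → TMCopy G H → Fin (size G) → Set
Uses {G} {H} M x = (∃[ w ] x ≡ φ M w) ⊎ (∃[ u ] ∃[ v ] Σ (Arc H u v) λ a → x ∈ path M u v a)

ContainsTM : Digraph → Digraph → Set
ContainsTM G H = TMCopy G H

ContainsTMAvoiding : (G H : Digraph) → Subset (size G) → Set
ContainsTMAvoiding G H S = Σ (TMCopy G H) λ M → ∀ x → Uses M x → x ∉ S

IsHitting : (G H : Digraph) → Subset (size G) → Set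
IsHitting G H S = ¬ ContainsTMAvoiding G H S

DisjointCopies : (G H : Digraph) → ℕ → Set
DisjointCopies G H k = Σ (Fin k → TMCopy G H) λ M →
  ∀ i j → i ≢ j → ∀ x → Uses (M i) x → ¬ Uses (M j) x

record IntervalDecomp (G : Digraph) : Set where
  field
    lo hi   : Fin (size G) → ℤ
    lo≤hi   : ∀ v → lo v ℤ.≤ hi v
    ordered : ∀ u v → hi u ℤ.< lo v → Arc G u v
open IntervalDecomp public

bagSize : ∀ {G} → IntervalDecomp G → ℤ → ℕ
bagSize {G} D α = length (filter (λ v → (lo D v ℤ.≤? α) ×-dec (α ℤ.≤? hi D v))
                                 (allFin (size G)))

PwTimesAtMost : Digraph → ℕ → ℕ → Set
PwTimesAtMost G q p = Σ (IntervalDecomp G) λ D → ∀ α → bagSize D α * q ≤ p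

-- Induction on k, splitting k = a + b in halves.  If a vertex set X of T carries
-- no k disjoint copies of H, then T[X] contains no copy of k·H, so it has an
-- interval decomposition of width at most d k‖H‖.  Sweeping a threshold α through
-- it yields an α such that the vertices strictly left of α carry no a disjoint
-- copies and those strictly right carry no b (right-of-α copies and left-of-(α+1)
-- copies would together give k).  Every arc between the two sides points to the
-- right, so a copy of the strongly connected H avoiding the bag at α lies on one
-- side; hence the bag plus hitting sets for both sides is H-hitting, of size
-- s(k) ≤ d k‖H‖ + s(a) + s(b) ≤ 2 d‖H‖ k log k.  Picking α constructively needs
-- a decision procedure for disjoint copies, which is an exhaustive finite search.
-- With d = dp/dq the bound is kept in the form 2^(|S| dq) ≤ (k^(2k))^(dp ‖H‖).

module Submission where

open import Defs
open import Data.Nat using (ℕ; zero; suc; _+_; _*_; _^_; _⊔_; _≤_; _<_; _≤?_; z≤n; s≤s)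
open import Data.Nat.Properties
  using ( ≤-trans; ≤-reflexive; ≰⇒>; n≤1+n; m≤m+n; m<m+n; m<n+m; m≤m⊔n; m≤n⊔m
        ; +-identityʳ; +-assoc; +-suc; +-monoʳ-≤; *-assoc; *-mono-≤; *-monoˡ-≤; *-monoʳ-≤
        ; ^-zeroˡ; ^-distribˡ-+-*; ^-*-assoc; ^-monoˡ-≤; ^-monoʳ-≤; module ≤-Reasoning)
open import Data.Nat.Solver using (module +-*-Solver)
open import Data.Nat.Induction using (<-rec)
open import Data.Nat.ListAction using (sum)
open import Data.Integer as ℤ using (ℤ; +_; -_; -[1+_]) renaming (suc to sucℤ)
import Data.Integer.Properties as ℤ
import Data.Integer.Solver as ℤ-Solver
open import Data.Bool using (Bool; true; false; T; if_then_else_)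
open import Data.Bool.Properties using (T?)
open import Data.Unit using (⊤; tt)
open import Data.Empty using (⊥; ⊥-elim)
open import Data.Product using (Σ; _×_; _,_; proj₁; proj₂; ∃-syntax; ∃₂)
open import Data.Sum using (_⊎_; inj₁; inj₂)
open import Data.List using (List; []; _∷_; length; lookup; map; allFin; filter; tabulate; _++_)
open import Data.List.Properties using (length-++; length-map)
open import Data.List.Relation.Unary.All as All using ()
open import Data.List.Relation.Unary.AllPairs using (_∷_)
open import Data.List.Relation.Unary.Any using (here; there; index)
open import Data.List.Relation.Unary.Any.Properties using (lookup-index)
open import Data.List.Membership.Propositional using (_∈_; _∉_)
open import Data.List.Membership.Propositional.Properties
  using (∈-lookup; ∈-map⁻; ∈-map⁺; ∈-filter⁻; ∈-filter⁺; ∈-allFin; ∈-++⁺ˡ; ∈-++⁺ʳ)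
open import Data.List.Membership.DecPropositional as ∈-Dec using ()
open import Data.List.Relation.Binary.Subset.Propositional using (_⊆_)
open import Data.List.Relation.Unary.Unique.Propositional using (Unique)
open import Data.List.Relation.Unary.Unique.Propositional.Properties as Unique using ()
open import Data.List.Relation.Unary.Unique.DecPropositional as Unique-Dec using ()
open import Data.Vec as Vec using (Vec; []; _∷_)
open import Data.Vec.Properties using (lookup∘tabulate)
open import Data.Vec.Relation.Unary.All using (All; []; _∷_; universal)
open import Data.Vec.Relation.Unary.All.Properties using (tabulate⁺)
open import Data.Fin using (Fin; zero; suc; _≟_; _↑ˡ_; _↑ʳ_; splitAt; join)
open import Data.Fin.Properties
  using (any?; all?; pigeonhole; <⇒≢; splitAt-↑ˡ; splitAt-↑ʳ; ↑ˡ-injective; ↑ʳ-injective; join-splitAt)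
open import Data.Fin.Subset using (Subset; ∣_∣; ⁅_⁆; _∪_; ⋃; inside; outside) renaming (_∈_ to _∈ₛ_)
open import Data.Fin.Subset.Properties using (∣⊥∣≡0; ∣⁅x⁆∣≡1; x∈⁅x⁆; x∈p∪q⁺)
open import Function using (_∘_; _∘′_)
open import Relation.Nullary using (Dec; yes; no; ¬_; ¬?; contradiction)
open import Relation.Nullary.Decidable using (map′; _×-dec_; _⊎-dec_; _→-dec_)
open import Relation.Unary using (Decidable)
open import Relation.Binary.PropositionalEquality

Searchable : (A : Set) → (A → Set) → Set₁
Searchable A B = (P : A → Set) → Decidable P → Dec (∃[ a ] B a × P a)

search-Fin : ∀ n → Searchable (Fin n) (λ _ → ⊤)
search-Fin n P P? = map′ (λ (a , p) → a , tt , p) (λ (a , _ , p) → a , p) (any? P?)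

search-List≤ : ∀ {A} → Searchable A (λ _ → ⊤) → ∀ n → Searchable (List A) (λ l → length l ≤ n)
search-List≤ sA n P P? with P? []
... | yes p = yes ([] , z≤n , p)
search-List≤ sA zero P P? | no ¬p = no λ { ([] , _ , p) → ¬p p ; (_ ∷ _ , () , _) }
search-List≤ sA (suc n) P P? | no ¬p
  with sA (λ x → ∃[ l ] length l ≤ n × P (x ∷ l))
          (λ x → search-List≤ sA n (λ l → P (x ∷ l)) (λ l → P? (x ∷ l)))
... | yes (x , _ , l , l≤n , p) = yes (x ∷ l , s≤s l≤n , p)
... | no ¬q = no λ { ([] , _ , p) → ¬p p
                   ; (x ∷ l , s≤s l≤n , p) → ¬q (x , tt , l , l≤n , p) }

search-Vec : ∀ {A B} → Searchable A B → ∀ h → Searchable (Vec A h) (All B)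
search-Vec sA zero P P? = map′ (λ p → [] , [] , p) (λ { ([] , _ , p) → p }) (P? [])
search-Vec {B = B} sA (suc h) P P?
  with sA (λ a → ∃[ v ] All B v × P (a ∷ v))
          (λ a → search-Vec sA h (λ v → P (a ∷ v)) (λ v → P? (a ∷ v)))
... | yes (a , ba , v , bv , p) = yes (a ∷ v , ba ∷ bv , p)
... | no ¬q = no λ { (a ∷ v , ba ∷ bv , p) → ¬q (a , ba , v , bv , p) }

search-× : ∀ {A B C D} → Searchable A B → Searchable C D →
           Searchable (A × C) (λ (a , c) → B a × D c)
search-× {D = D} sA sC P P?
  with sA (λ a → ∃[ c ] D c × P (a , c)) (λ a → sC (λ c → P (a , c)) (λ c → P? (a , c)))
... | yes (a , ba , c , dc , p) = yes ((a , c) , (ba , dc) , p)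
... | no ¬q = no λ { ((a , c) , (ba , dc) , p) → ¬q (a , ba , c , dc , p) }

lookup-injective : ∀ {A : Set} {xs : List A} → Unique xs →
                   ∀ i j → lookup xs i ≡ lookup xs j → i ≡ j
lookup-injective (_ ∷ _) zero zero _ = refl
lookup-injective (x∉xs ∷ _) zero (suc j) eq = ⊥-elim (All.lookup x∉xs (∈-lookup j) eq)
lookup-injective (x∉xs ∷ _) (suc i) zero eq = ⊥-elim (All.lookup x∉xs (∈-lookup i) (sym eq))
lookup-injective (_ ∷ uniq) (suc i) (suc j) eq = cong suc (lookup-injective uniq i j eq)

unique-length≤ : ∀ {n} {xs : List (Fin n)} → Unique xs → length xs ≤ n
unique-length≤ {n} {xs} uniq with length xs ≤? n
... | yes xs≤n = xs≤n
... | no xs≰n with pigeonhole (≰⇒> xs≰n) (lookup xs)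
...   | i , j , i<j , eq = ⊥-elim (<⇒≢ i<j (lookup-injective uniq i j eq))

module _ {A : Set} {m} (f : Fin m → A) {P : Fin m → Set} (P? : Decidable P) where
  ∈-map-filter⁻ : ∀ {x} → x ∈ map f (filter P? (allFin m)) → ∃[ i ] x ≡ f i × P i
  ∈-map-filter⁻ x∈ with ∈-map⁻ f x∈
  ... | i , i∈ , x≡fi = i , x≡fi , proj₂ (∈-filter⁻ P? {xs = allFin m} i∈)

  ∈-map-filter⁺ : ∀ {i} → P i → f i ∈ map f (filter P? (allFin m))
  ∈-map-filter⁺ {i} p = ∈-map⁺ f (∈-filter⁺ P? (∈-allFin i) p)

-- A discrete intermediate value argument.
sweep : {P Q : ℕ → Set} → Decidable Q → (∀ i → Q i → ¬ P (suc i)) →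
        ∀ N → ¬ P 0 → ¬ Q N → ∃[ i ] ¬ P i × ¬ Q i
sweep Q? Q⇒¬P N ¬P0 ¬QN with Q? 0
... | no ¬Q0 = 0 , ¬P0 , ¬Q0
sweep Q? Q⇒¬P zero    ¬P0 ¬QN | yes Q0 = contradiction Q0 ¬QN
sweep {P} {Q} Q? Q⇒¬P (suc N) ¬P0 ¬QN | yes Q0
  with sweep {λ i → P (suc i)} {λ i → Q (suc i)} (λ i → Q? (suc i)) (λ i → Q⇒¬P (suc i)) N (Q⇒¬P 0 Q0) ¬QN
... | i , ¬Pi , ¬Qi = suc i , ¬Pi , ¬Qi

∣∣-bound : ∀ {m} (g : Fin m → ℤ) → ∃[ B ] ∀ v → ℤ.∣ g v ∣ ≤ B
∣∣-bound {zero}  g = 0 , λ ()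
∣∣-bound {suc m} g with ∣∣-bound (λ v → g (suc v))
... | B , bound = ℤ.∣ g zero ∣ ⊔ B , λ { zero → m≤m⊔n _ B ; (suc v) → ≤-trans (bound v) (m≤n⊔m _ B) }

i≤+∣i∣ : ∀ i → i ℤ.≤ + ℤ.∣ i ∣
i≤+∣i∣ (+ n)    = ℤ.≤-refl
i≤+∣i∣ -[1+ n ] = ℤ.-≤+

-+∣i∣≤i : ∀ i → - (+ ℤ.∣ i ∣) ℤ.≤ i
-+∣i∣≤i (+ n)    = ℤ.neg-≤-pos
-+∣i∣≤i -[1+ n ] = ℤ.≤-refl

Φ : ℕ → ℕ
Φ k = k ^ (2 * k)

^-distribʳ-* : ∀ m n o → (m * n) ^ o ≡ m ^ o * n ^ o
^-distribʳ-* m n zero    = refl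
^-distribʳ-* m n (suc o) rewrite ^-distribʳ-* m n o =
  solve 4 (λ m n p q → (m :* n) :* (p :* q) := (m :* p) :* (n :* q)) refl m n (m ^ o) (n ^ o)
  where open +-*-Solver

split-bound-even : ∀ m → 2 ^ (m + m) * (Φ m * Φ m) ≤ Φ (m + m)
split-bound-even m = begin
  2 ^ (m + m) * (m ^ (2 * m) * m ^ (2 * m))
    ≡⟨ cong (2 ^ (m + m) *_) (trans (sym (^-distribˡ-+-* m (2 * m) (2 * m))) (cong (m ^_) 4m≡2[m+m])) ⟩
  2 ^ (m + m) * m ^ (2 * (m + m))
    ≤⟨ *-monoˡ-≤ (m ^ (2 * (m + m))) (^-monoʳ-≤ 2 (m≤m+n (m + m) (m + m + 0))) ⟩
  2 ^ (2 * (m + m)) * m ^ (2 * (m + m))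
    ≡⟨ sym (^-distribʳ-* 2 m (2 * (m + m))) ⟩
  (2 * m) ^ (2 * (m + m))
    ≡⟨ cong (λ x → (m + x) ^ (2 * (m + m))) (+-identityʳ m) ⟩
  (m + m) ^ (2 * (m + m)) ∎
  where
  open ≤-Reasoning
  open +-*-Solver
  4m≡2[m+m] : 2 * m + 2 * m ≡ 2 * (m + m)
  4m≡2[m+m] = solve 1 (λ m → con 2 :* m :+ con 2 :* m := con 2 :* (m :+ m)) refl m

-- With a = b + 1 and k = a + b: 2^k a^(2a) b^(2b) = 2 4^b a² (ab)^(2b), and 4ab ≤ k².
split-bound-odd : ∀ b → 1 ≤ b → 2 ^ (suc b + b) * (Φ (suc b) * Φ b) ≤ Φ (suc b + b)
split-bound-odd b 1≤b = begin
  2 ^ k * (a ^ (2 * a) * b ^ (2 * b))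
    ≡⟨ cong₂ _*_ 2^k≡2*4^b (cong (_* b ^ (2 * b)) (trans (cong (a ^_) 2a≡2+2b) (^-distribˡ-+-* a 2 (2 * b)))) ⟩
  (2 * 4 ^ b) * ((a ^ 2 * a ^ (2 * b)) * b ^ (2 * b))
    ≡⟨ cong ((2 * 4 ^ b) *_) (trans (*-assoc (a ^ 2) (a ^ (2 * b)) (b ^ (2 * b)))
                                    (cong (a ^ 2 *_) (sym (^-distribʳ-* a b (2 * b))))) ⟩
  (2 * 4 ^ b) * (a ^ 2 * (a * b) ^ (2 * b))
    ≡⟨ sym (*-assoc (2 * 4 ^ b) (a ^ 2) ((a * b) ^ (2 * b))) ⟩
  (2 * 4 ^ b * a ^ 2) * (a * b) ^ (2 * b)
    ≤⟨ *-monoˡ-≤ ((a * b) ^ (2 * b)) (*-mono-≤ 2*4^b≤4^2b (^-monoˡ-≤ 2 (m≤m+n a b))) ⟩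
  (4 ^ (2 * b) * k ^ 2) * (a * b) ^ (2 * b)
    ≡⟨ solve 3 (λ x y z → (x :* y) :* z := y :* (x :* z)) refl (4 ^ (2 * b)) (k ^ 2) ((a * b) ^ (2 * b)) ⟩
  k ^ 2 * (4 ^ (2 * b) * (a * b) ^ (2 * b))
    ≡⟨ cong (k ^ 2 *_) (sym (^-distribʳ-* 4 (a * b) (2 * b))) ⟩
  k ^ 2 * (4 * (a * b)) ^ (2 * b)
    ≤⟨ *-monoʳ-≤ (k ^ 2) (^-monoˡ-≤ (2 * b) 4ab≤k²) ⟩
  k ^ 2 * (k ^ 2) ^ (2 * b)
    ≡⟨ cong (k ^ 2 *_) (^-*-assoc k 2 (2 * b)) ⟩
  k ^ 2 * k ^ (2 * (2 * b))
    ≡⟨ sym (^-distribˡ-+-* k 2 (2 * (2 * b))) ⟩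
  k ^ (2 + 2 * (2 * b))
    ≡⟨ cong (k ^_) 2+4b≡2k ⟩
  k ^ (2 * k) ∎
  where
  open ≤-Reasoning
  open +-*-Solver
  a = suc b
  k = a + b
  2^k≡2*4^b : 2 ^ k ≡ 2 * 4 ^ b
  2^k≡2*4^b = cong (2 *_) (trans (cong (2 ^_) (solve 1 (λ b → b :+ b := con 2 :* b) refl b))
                                  (sym (^-*-assoc 2 2 b)))
  2a≡2+2b : 2 * a ≡ 2 + 2 * b
  2a≡2+2b = solve 1 (λ b → con 2 :* (con 1 :+ b) := con 2 :+ con 2 :* b) refl b
  2+4b≡2k : 2 + 2 * (2 * b) ≡ 2 * k
  2+4b≡2k = solve 1 (λ b → con 2 :+ con 2 :* (con 2 :* b) := con 2 :* ((con 1 :+ b) :+ b)) refl b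
  4ab≤k² : 4 * (a * b) ≤ k ^ 2
  4ab≤k² = subst (4 * (a * b) ≤_)
    (solve 1 (λ b → con 1 :+ con 4 :* ((con 1 :+ b) :* b)
                    := ((con 1 :+ b) :+ b) :* (((con 1 :+ b) :+ b) :* con 1)) refl b)
    (n≤1+n _)
  2*4^b≤4^2b : 2 * 4 ^ b ≤ 4 ^ (2 * b)
  2*4^b≤4^2b = begin
    2 * 4 ^ b     ≤⟨ *-monoˡ-≤ (4 ^ b) {2} {4} (s≤s (s≤s z≤n)) ⟩
    4 * 4 ^ b     ≤⟨ *-monoˡ-≤ (4 ^ b) (^-monoʳ-≤ 4 1≤b) ⟩
    4 ^ b * 4 ^ b ≡⟨ sym (^-distribˡ-+-* 4 b b) ⟩
    4 ^ (b + b)   ≡⟨ cong (λ x → 4 ^ (b + x)) (sym (+-identityʳ b)) ⟩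
    4 ^ (2 * b)   ∎

parity : ∀ k → ∃[ m ] (k ≡ m + m ⊎ k ≡ suc m + m)
parity zero = 0 , inj₁ refl
parity (suc k) with parity k
... | m , inj₁ k≡2m   = m , inj₂ (cong suc k≡2m)
... | m , inj₂ k≡2m+1 = suc m , inj₁ (cong suc (trans k≡2m+1 (sym (+-suc m m))))

balanced-split : ∀ k → 2 ≤ k →
  ∃₂ λ a b → 1 ≤ a × 1 ≤ b × a + b ≡ k × 2 ^ k * (Φ a * Φ b) ≤ Φ k
balanced-split (suc zero) (s≤s ())
balanced-split (suc (suc j)) _ with parity j
... | m , inj₁ j≡2m = suc m , suc m , s≤s z≤n , s≤s z≤n , eq ,
  subst (λ k → 2 ^ k * (Φ (suc m) * Φ (suc m)) ≤ Φ k) eq (split-bound-even (suc m))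
  where eq = cong suc (trans (+-suc m m) (cong suc (sym j≡2m)))
... | m , inj₂ j≡2m+1 = suc (suc m) , suc m , s≤s z≤n , s≤s z≤n , eq ,
  subst (λ k → 2 ^ k * (Φ (suc (suc m)) * Φ (suc m)) ≤ Φ k) eq (split-bound-odd (suc m) (s≤s z≤n))
  where eq = cong (λ x → suc (suc x)) (trans (+-suc m m) (sym j≡2m+1))

-- The recurrence s(k) ≤ C k + s(a) + s(b), in exponential form.
combine-bounds : ∀ C dq {k a b} l s r → l * dq ≤ k * C →
  2 ^ (s * dq) ≤ Φ a ^ C → 2 ^ (r * dq) ≤ Φ b ^ C → 2 ^ k * (Φ a * Φ b) ≤ Φ k →
  2 ^ ((l + (s + r)) * dq) ≤ Φ k ^ C
combine-bounds C dq {k} {a} {b} l s r hl hs hr split = begin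
  2 ^ ((l + (s + r)) * dq)
    ≡⟨ cong (2 ^_) (solve 4 (λ l s r d → (l :+ (s :+ r)) :* d := l :* d :+ (s :* d :+ r :* d)) refl l s r dq) ⟩
  2 ^ (l * dq + (s * dq + r * dq))
    ≡⟨ trans (^-distribˡ-+-* 2 (l * dq) _) (cong (2 ^ (l * dq) *_) (^-distribˡ-+-* 2 (s * dq) _)) ⟩
  2 ^ (l * dq) * (2 ^ (s * dq) * 2 ^ (r * dq))
    ≤⟨ *-mono-≤ (^-monoʳ-≤ 2 hl) (*-mono-≤ hs hr) ⟩
  2 ^ (k * C) * (Φ a ^ C * Φ b ^ C)
    ≡⟨ cong₂ _*_ (sym (^-*-assoc 2 k C)) (sym (^-distribʳ-* (Φ a) (Φ b) C)) ⟩
  (2 ^ k) ^ C * (Φ a * Φ b) ^ C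
    ≡⟨ sym (^-distribʳ-* (2 ^ k) (Φ a * Φ b) C) ⟩
  (2 ^ k * (Φ a * Φ b)) ^ C
    ≤⟨ ^-monoˡ-≤ C split ⟩
  Φ k ^ C ∎
  where open ≤-Reasoning
        open +-*-Solver

∣p∪q∣≤∣p∣+∣q∣ : ∀ {n} (p q : Subset n) → ∣ p ∪ q ∣ ≤ ∣ p ∣ + ∣ q ∣
∣p∪q∣≤∣p∣+∣q∣ []            []            = z≤n
∣p∪q∣≤∣p∣+∣q∣ (outside ∷ p) (outside ∷ q) = ∣p∪q∣≤∣p∣+∣q∣ p q
∣p∪q∣≤∣p∣+∣q∣ (outside ∷ p) (inside ∷ q)  =
  subst (suc ∣ p ∪ q ∣ ≤_) (sym (+-suc ∣ p ∣ ∣ q ∣)) (s≤s (∣p∪q∣≤∣p∣+∣q∣ p q))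
∣p∪q∣≤∣p∣+∣q∣ (inside ∷ p)  (outside ∷ q) = s≤s (∣p∪q∣≤∣p∣+∣q∣ p q)
∣p∪q∣≤∣p∣+∣q∣ (inside ∷ p)  (inside ∷ q)  =
  s≤s (≤-trans (∣p∪q∣≤∣p∣+∣q∣ p q) (+-monoʳ-≤ ∣ p ∣ (n≤1+n ∣ q ∣)))

fromList : ∀ {n} → List (Fin n) → Subset n
fromList xs = ⋃ (map ⁅_⁆ xs)

∣fromList∣≤length : ∀ {n} (xs : List (Fin n)) → ∣ fromList xs ∣ ≤ length xs
∣fromList∣≤length {n} []       = ≤-reflexive (∣⊥∣≡0 n)
∣fromList∣≤length (x ∷ xs) = ≤-trans (∣p∪q∣≤∣p∣+∣q∣ ⁅ x ⁆ (fromList xs))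
  (subst (λ c → c + ∣ fromList xs ∣ ≤ suc (length xs)) (sym (∣⁅x⁆∣≡1 x)) (s≤s (∣fromList∣≤length xs)))

∈-fromList : ∀ {n} {x : Fin n} {xs} → x ∈ xs → x ∈ₛ fromList xs
∈-fromList (here refl) = x∈p∪q⁺ (inj₁ (x∈⁅x⁆ _))
∈-fromList (there x∈)  = x∈p∪q⁺ (inj₂ (∈-fromList x∈))

∑ : ∀ m → (Fin m → ℕ) → ℕ
∑ zero    g = 0
∑ (suc m) g = g zero + ∑ m (λ i → g (suc i))

∑-cong : ∀ m {g g' : Fin m → ℕ} → (∀ i → g i ≡ g' i) → ∑ m g ≡ ∑ m g'
∑-cong zero    eq = refl
∑-cong (suc m) eq = cong₂ _+_ (eq zero) (∑-cong m (λ i → eq (suc i)))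

∑-zero : ∀ m {g : Fin m → ℕ} → (∀ i → g i ≡ 0) → ∑ m g ≡ 0
∑-zero zero    eq = refl
∑-zero (suc m) eq = cong₂ _+_ (eq zero) (∑-zero m (λ i → eq (suc i)))

∑-+ : ∀ a b (g : Fin (a + b) → ℕ) → ∑ (a + b) g ≡ ∑ a (λ i → g (i ↑ˡ b)) + ∑ b (λ j → g (a ↑ʳ j))
∑-+ zero    b g = refl
∑-+ (suc a) b g = trans (cong (_+_ (g zero)) (∑-+ a b (λ i → g (suc i)))) (sym (+-assoc (g zero) _ _))

sum-map-tabulate : ∀ {A : Set} m (t : Fin m → A) (g : A → ℕ) →
                   sum (map g (tabulate t)) ≡ ∑ m (λ i → g (t i))
sum-map-tabulate zero    t g = refl
sum-map-tabulate (suc m) t g = cong (_+_ (g (t zero))) (sum-map-tabulate m (λ i → t (suc i)) g)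

infixr 6 _⊕_
infixr 7 _·_

_⊕_ : Digraph → Digraph → Digraph
X ⊕ Y = record
  { size = size X + size Y
  ; arc = λ i j → arc⊎ (splitAt (size X) i) (splitAt (size X) j)
  ; loopless = λ i → loopless⊎ (splitAt (size X) i) }
  where
  arc⊎ : Fin (size X) ⊎ Fin (size Y) → Fin (size X) ⊎ Fin (size Y) → Bool
  arc⊎ (inj₁ i) (inj₁ j) = arc X i j
  arc⊎ (inj₂ i) (inj₂ j) = arc Y i j
  arc⊎ _        _        = false
  loopless⊎ : ∀ s → arc⊎ s s ≡ false
  loopless⊎ (inj₁ i) = loopless X i
  loopless⊎ (inj₂ i) = loopless Y i

∅ᴰ : Digraph
∅ᴰ = record { size = 0 ; arc = λ () ; loopless = λ () }

_·_ : ℕ → Digraph → Digraph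
zero  · H = ∅ᴰ
suc k · H = H ⊕ k · H

module _ (X Y : Digraph) where
  private
    a = size X
    b = size Y

  arc-⊕-ˡˡ : ∀ i j → arc (X ⊕ Y) (i ↑ˡ b) (j ↑ˡ b) ≡ arc X i j
  arc-⊕-ˡˡ i j rewrite splitAt-↑ˡ a i b | splitAt-↑ˡ a j b = refl

  arc-⊕-ʳʳ : ∀ i j → arc (X ⊕ Y) (a ↑ʳ i) (a ↑ʳ j) ≡ arc Y i j
  arc-⊕-ʳʳ i j rewrite splitAt-↑ʳ a b i | splitAt-↑ʳ a b j = refl

  arc-⊕-ˡʳ : ∀ i j → arc (X ⊕ Y) (i ↑ˡ b) (a ↑ʳ j) ≡ false
  arc-⊕-ˡʳ i j rewrite splitAt-↑ˡ a i b | splitAt-↑ʳ a b j = refl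

  arc-⊕-ʳˡ : ∀ i j → arc (X ⊕ Y) (a ↑ʳ j) (i ↑ˡ b) ≡ false
  arc-⊕-ʳˡ i j rewrite splitAt-↑ˡ a i b | splitAt-↑ʳ a b j = refl

  ↑ˡ≢↑ʳ : ∀ (i : Fin a) (j : Fin b) → i ↑ˡ b ≢ a ↑ʳ j
  ↑ˡ≢↑ʳ i j eq with trans (sym (splitAt-↑ˡ a i b)) (trans (cong (splitAt a) eq) (splitAt-↑ʳ a b j))
  ... | ()

module Restrict {G P Q : Digraph} (g : Fin (size P) → Fin (size Q))
  (g-inj : ∀ a b → g a ≡ g b → a ≡ b)
  (g-arc : ∀ a b → arc Q (g a) (g b) ≡ arc P a b) where

  arc-g : ∀ {a b} → Arc P a b → Arc Q (g a) (g b)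
  arc-g {a} {b} = subst T (sym (g-arc a b))

  restrict : TMCopy G Q → TMCopy G P
  restrict M = record
    { φ = φ M ∘′ g
    ; φ-inj = λ u v eq → g-inj u v (φ-inj M (g u) (g v) eq)
    ; path = λ u v a → path M (g u) (g v) (arc-g a)
    ; path-walk = λ u v a → path-walk M (g u) (g v) (arc-g a)
    ; path-unique = λ u v a → path-unique M (g u) (g v) (arc-g a)
    ; path-avoid = λ u v a x x∈ w → path-avoid M (g u) (g v) (arc-g a) x x∈ (g w)
    ; path-disj = λ u v a u' v' a' x x∈ x∈' →
        let (u≡u' , v≡v') = path-disj M (g u) (g v) (arc-g a) (g u') (g v') (arc-g a') x x∈ x∈'
        in g-inj u u' u≡u' , g-inj v v' v≡v' }

  Uses-restrict : ∀ M x → Uses (restrict M) x → Uses M x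
  Uses-restrict M x (inj₁ (w , eq)) = inj₁ (g w , eq)
  Uses-restrict M x (inj₂ (u , v , a , x∈)) = inj₂ (g u , g v , arc-g a , x∈)

·-copy⇒disjoint-copies : ∀ {G} H k (M : TMCopy G (k · H)) → Σ (Fin k → TMCopy G H) λ F →
  (∀ i j → i ≢ j → ∀ x → Uses (F i) x → ¬ Uses (F j) x) × (∀ i x → Uses (F i) x → Uses M x)
·-copy⇒disjoint-copies H zero M = (λ ()) , (λ ()) , (λ ())
·-copy⇒disjoint-copies {G} H (suc k) M = F , disjoint , uses
  where
  module L = Restrict {G} {Q = H ⊕ k · H} (_↑ˡ size (k · H)) (↑ˡ-injective (size (k · H))) (arc-⊕-ˡˡ H (k · H))
  module R = Restrict {G} {Q = H ⊕ k · H} (size H ↑ʳ_) (↑ʳ-injective (size H)) (arc-⊕-ʳʳ H (k · H))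
  rest = ·-copy⇒disjoint-copies H k (R.restrict M)
  F : Fin (suc k) → TMCopy G H
  F zero    = L.restrict M
  F (suc i) = proj₁ rest i
  uses : ∀ i x → Uses (F i) x → Uses M x
  uses zero    x u = L.Uses-restrict M x u
  uses (suc i) x u = R.Uses-restrict M x (proj₂ (proj₂ rest) i x u)
  first-vs-rest : ∀ x → Uses (L.restrict M) x → ¬ Uses (R.restrict M) x
  first-vs-rest x (inj₁ (w , e)) (inj₁ (w' , e')) = ↑ˡ≢↑ʳ H (k · H) w w' (φ-inj M _ _ (trans (sym e) e'))
  first-vs-rest x (inj₁ (w , e)) (inj₂ (_ , _ , _ , x∈)) = path-avoid M _ _ _ x x∈ _ e
  first-vs-rest x (inj₂ (_ , _ , _ , x∈)) (inj₁ (w , e)) = path-avoid M _ _ _ x x∈ _ e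
  first-vs-rest x (inj₂ (u , _ , _ , x∈)) (inj₂ (u' , _ , _ , x∈')) =
    ↑ˡ≢↑ʳ H (k · H) u u' (proj₁ (path-disj M _ _ _ _ _ _ x x∈ x∈'))
  disjoint : ∀ i j → i ≢ j → ∀ x → Uses (F i) x → ¬ Uses (F j) x
  disjoint zero    zero    i≢j = ⊥-elim (i≢j refl)
  disjoint zero    (suc j) _ x u u' = first-vs-rest x u (proj₂ (proj₂ rest) j x u')
  disjoint (suc i) zero    _ x u u' = first-vs-rest x u' (proj₂ (proj₂ rest) i x u)
  disjoint (suc i) (suc j) i≢j = proj₁ (proj₂ rest) i j (i≢j ∘ cong suc)

count : Bool → ℕ
count b = if b then 1 else 0

arcCount : Digraph → ℕ
arcCount G = ∑ (size G) λ u → ∑ (size G) λ v → count (arc G u v)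

numArcs≡arcCount : ∀ G → numArcs G ≡ arcCount G
numArcs≡arcCount G = trans (sum-map-tabulate (size G) (λ i → i) _)
  (∑-cong (size G) λ u → sum-map-tabulate (size G) (λ i → i) _)

arcCount-⊕ : ∀ X Y → arcCount (X ⊕ Y) ≡ arcCount X + arcCount Y
arcCount-⊕ X Y = trans (∑-+ a b row) (cong₂ _+_ (∑-cong a row-X) (∑-cong b row-Y))
  where
  a = size X
  b = size Y
  row : Fin (a + b) → ℕ
  row u = ∑ (a + b) λ v → count (arc (X ⊕ Y) u v)
  row-X : ∀ i → row (i ↑ˡ b) ≡ ∑ a λ j → count (arc X i j)
  row-X i = begin
    row (i ↑ˡ b)
      ≡⟨ ∑-+ a b _ ⟩
    ∑ a (λ j → count (arc (X ⊕ Y) (i ↑ˡ b) (j ↑ˡ b))) + ∑ b (λ j → count (arc (X ⊕ Y) (i ↑ˡ b) (a ↑ʳ j)))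
      ≡⟨ cong₂ _+_ (∑-cong a λ j → cong count (arc-⊕-ˡˡ X Y i j))
                   (∑-zero b λ j → cong count (arc-⊕-ˡʳ X Y i j)) ⟩
    ∑ a (λ j → count (arc X i j)) + 0
      ≡⟨ +-identityʳ _ ⟩
    ∑ a (λ j → count (arc X i j)) ∎
    where open ≡-Reasoning
  row-Y : ∀ i → row (a ↑ʳ i) ≡ ∑ b λ j → count (arc Y i j)
  row-Y i = trans (∑-+ a b _) (cong₂ _+_ (∑-zero a λ j → cong count (arc-⊕-ʳˡ X Y j i))
                                         (∑-cong b λ j → cong count (arc-⊕-ʳʳ X Y i j)))

‖⊕‖ : ∀ X Y → ‖ X ⊕ Y ‖ ≡ ‖ X ‖ + ‖ Y ‖
‖⊕‖ X Y rewrite numArcs≡arcCount (X ⊕ Y) | numArcs≡arcCount X | numArcs≡arcCount Y | arcCount-⊕ X Y =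
  solve 4 (λ a b c d → (a :+ b) :+ (c :+ d) := (a :+ c) :+ (b :+ d)) refl
          (size X) (size Y) (arcCount X) (arcCount Y)
  where open +-*-Solver

‖·‖ : ∀ k H → ‖ k · H ‖ ≡ k * ‖ H ‖
‖·‖ zero    H = refl
‖·‖ (suc k) H = trans (‖⊕‖ H (k · H)) (cong (_+_ ‖ H ‖) (‖·‖ k H))

DisjointCopiesWithin : (G H : Digraph) → List (Fin (size G)) → ℕ → Set
DisjointCopiesWithin G H ys k = Σ (Fin k → TMCopy G H) λ M →
  (∀ i j → i ≢ j → ∀ x → Uses (M i) x → ¬ Uses (M j) x) × (∀ i x → Uses (M i) x → x ∈ ys)

disjoint-copies-++ : ∀ {G H} {ys zs ws : List (Fin (size G))} {a b} →
  (∀ {x} → x ∈ ys → x ∈ zs → ⊥) → ys ⊆ ws → zs ⊆ ws →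
  DisjointCopiesWithin G H ys a → DisjointCopiesWithin G H zs b → DisjointCopiesWithin G H ws (a + b)
disjoint-copies-++ {G} {H} {a = a} {b} ys∩zs ys⊆ws zs⊆ws (F , F-disj , F-in) (F' , F'-disj , F'-in) =
  (λ i → copies (splitAt a i)) , disjoint , λ i x u → within (splitAt a i) x u
  where
  copies : Fin a ⊎ Fin b → TMCopy G H
  copies (inj₁ i) = F i
  copies (inj₂ j) = F' j
  within : ∀ s x → Uses (copies s) x → x ∈ _
  within (inj₁ i) x u = ys⊆ws (F-in i x u)
  within (inj₂ j) x u = zs⊆ws (F'-in j x u)
  disjoint⊎ : ∀ s t → s ≢ t → ∀ x → Uses (copies s) x → ¬ Uses (copies t) x
  disjoint⊎ (inj₁ i) (inj₁ j) s≢t = F-disj i j (s≢t ∘ cong inj₁)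
  disjoint⊎ (inj₂ i) (inj₂ j) s≢t = F'-disj i j (s≢t ∘ cong inj₂)
  disjoint⊎ (inj₁ i) (inj₂ j) _ x u u' = ys∩zs (F-in i x u) (F'-in j x u')
  disjoint⊎ (inj₂ i) (inj₁ j) _ x u u' = ys∩zs (F-in j x u') (F'-in i x u)
  disjoint : ∀ i j → i ≢ j → ∀ x → Uses (copies (splitAt a i)) x → ¬ Uses (copies (splitAt a j)) x
  disjoint i j i≢j = disjoint⊎ (splitAt a i) (splitAt a j) λ eq →
    i≢j (trans (sym (join-splitAt a b i)) (trans (cong (join a b) eq) (join-splitAt a b j)))

-- A path of a copy as a total function of the two endpoints.
when : ∀ {X : Set} (b : Bool) → (T b → List X) → List X
when true  g = g tt
when false g = []

when-T : ∀ {X : Set} {b : Bool} (g : T b → List X) (t : T b) → when b g ≡ g t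
when-T {b = true} g tt = refl

module DecideCopies (G H : Digraph) where
  private
    n = size G
    h = size H
  open ∈-Dec (_≟_ {n}) using (_∈?_)
  open Unique-Dec (_≟_ {n}) using (unique?)

  walk? : ∀ a l b → Dec (WalkVia G a l b)
  walk? a []       b = T? (arc G a b)
  walk? a (x ∷ l) b = T? (arc G a x) ×-dec walk? x l b

  -- A copy of H is determined by finitely much data: branch vertices and paths,
  -- and the paths of a copy can be taken without repetitions, hence of length ≤ n.
  Certificate : Set
  Certificate = Vec (Fin n) h × Vec (Vec (List (Fin n)) h) h

  Short : Certificate → Set
  Short (_ , ps) = All (All (λ l → length l ≤ n)) ps

  search-Certificate : Searchable Certificate (λ c → All (λ _ → ⊤) (proj₁ c) × Short c)
  search-Certificate =
    search-× (search-Vec (search-Fin n) h) (search-Vec (search-Vec (search-List≤ (search-Fin n) n) h) h)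

  branch : Certificate → Fin h → Fin n
  branch c = Vec.lookup (proj₁ c)

  route : Certificate → Fin h → Fin h → List (Fin n)
  route c u v = Vec.lookup (Vec.lookup (proj₂ c) u) v

  IsCopy : Certificate → Set
  IsCopy c =
      (∀ u v → branch c u ≡ branch c v → u ≡ v)
    × (∀ u v → Arc H u v → WalkVia G (branch c u) (route c u v) (branch c v))
    × (∀ u v → Arc H u v → Unique (route c u v))
    × (∀ u v → Arc H u v → ∀ x → x ∈ route c u v → ∀ w → x ≢ branch c w)
    × (∀ u v → Arc H u v → ∀ u' v' → Arc H u' v' → ∀ x →
         x ∈ route c u v → x ∈ route c u' v' → u ≡ u' × v ≡ v')

  isCopy? : ∀ c → Dec (IsCopy c)
  isCopy? c =
    all? (λ u → all? λ v → (branch c u ≟ branch c v) →-dec (u ≟ v)) ×-dec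
    all? (λ u → all? λ v → T? (arc H u v) →-dec walk? (branch c u) (route c u v) (branch c v)) ×-dec
    all? (λ u → all? λ v → T? (arc H u v) →-dec unique? (route c u v)) ×-dec
    all? (λ u → all? λ v → T? (arc H u v) →-dec all? λ x →
      (x ∈? route c u v) →-dec all? λ w → ¬? (x ≟ branch c w)) ×-dec
    all? (λ u → all? λ v → T? (arc H u v) →-dec all? λ u' → all? λ v' →
      T? (arc H u' v') →-dec all? λ x →
      (x ∈? route c u v) →-dec (x ∈? route c u' v') →-dec (u ≟ u') ×-dec (v ≟ v'))

  copy : (c : Certificate) → IsCopy c → TMCopy G H
  copy c (inj , walk , unique , avoid , disj) = record
    { φ = branch c ; φ-inj = inj ; path = λ u v _ → route c u v
    ; path-walk = walk ; path-unique = unique ; path-avoid = avoid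
    ; path-disj = λ u v a u' v' a' → disj u v a u' v' a' }

  UsesC : Certificate → Fin n → Set
  UsesC c x = (∃[ w ] x ≡ branch c w) ⊎ (∃[ u ] ∃[ v ] Arc H u v × x ∈ route c u v)

  usesC? : ∀ c → Decidable (UsesC c)
  usesC? c x = any? (λ w → x ≟ branch c w) ⊎-dec
    any? (λ u → any? λ v → T? (arc H u v) ×-dec (x ∈? route c u v))

  certificate : TMCopy G H → Certificate
  certificate M = Vec.tabulate (φ M) , Vec.tabulate λ u → Vec.tabulate λ v → when (arc H u v) (path M u v)

  module _ (M : TMCopy G H) where
    private
      c = certificate M

      branch-certificate : ∀ w → branch c w ≡ φ M w
      branch-certificate = lookup∘tabulate (φ M)

      route-certificate : ∀ u v (a : Arc H u v) → route c u v ≡ path M u v a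
      route-certificate u v a = trans (cong (λ r → Vec.lookup r v) (lookup∘tabulate _ u))
                                      (trans (lookup∘tabulate _ v) (when-T (path M u v) a))

      ∈-route : ∀ {u v x} (a : Arc H u v) → x ∈ route c u v → x ∈ path M u v a
      ∈-route {x = x} a = subst (x ∈_) (route-certificate _ _ a)

    certificate-short : Short c
    certificate-short = tabulate⁺ λ u → tabulate⁺ λ v → short u v
      where
      short : ∀ u v → length (when (arc H u v) (path M u v)) ≤ n
      short u v with arc H u v | path M u v | path-unique M u v
      ... | true  | _ | unique = unique-length≤ (unique tt)
      ... | false | _ | _      = z≤n

    certificate-isCopy : IsCopy c
    certificate-isCopy = inj , walk , unique , avoid , disj
      where
      inj : ∀ u v → branch c u ≡ branch c v → u ≡ v
      inj u v eq = φ-inj M u v (trans (sym (branch-certificate u)) (trans eq (branch-certificate v)))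
      walk : ∀ u v → Arc H u v → WalkVia G (branch c u) (route c u v) (branch c v)
      walk u v a rewrite branch-certificate u | branch-certificate v | route-certificate u v a =
        path-walk M u v a
      unique : ∀ u v → Arc H u v → Unique (route c u v)
      unique u v a rewrite route-certificate u v a = path-unique M u v a
      avoid : ∀ u v → Arc H u v → ∀ x → x ∈ route c u v → ∀ w → x ≢ branch c w
      avoid u v a x x∈ w eq = path-avoid M u v a x (∈-route a x∈) w (trans eq (branch-certificate w))
      disj : ∀ u v → Arc H u v → ∀ u' v' → Arc H u' v' → ∀ x →
             x ∈ route c u v → x ∈ route c u' v' → u ≡ u' × v ≡ v'
      disj u v a u' v' a' x x∈ x∈' = path-disj M u v a u' v' a' x (∈-route a x∈) (∈-route a' x∈')

    Uses-certificate : ∀ x → UsesC c x → Uses M x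
    Uses-certificate x (inj₁ (w , eq)) = inj₁ (w , trans eq (branch-certificate w))
    Uses-certificate x (inj₂ (u , v , a , x∈)) = inj₂ (u , v , a , ∈-route a x∈)

  private
    DisjointWithin : List (Fin n) → ∀ {k} → Vec Certificate k → Set
    DisjointWithin ys cs = (∀ i → IsCopy (Vec.lookup cs i))
      × (∀ i j → i ≢ j → ∀ x → UsesC (Vec.lookup cs i) x → ¬ UsesC (Vec.lookup cs j) x)
      × (∀ i x → UsesC (Vec.lookup cs i) x → x ∈ ys)

    disjointWithin? : ∀ ys {k} → Decidable (DisjointWithin ys {k})
    disjointWithin? ys cs = all? (λ i → isCopy? (Vec.lookup cs i)) ×-dec
      all? (λ i → all? λ j → ¬? (i ≟ j) →-dec all? λ x →
        usesC? (Vec.lookup cs i) x →-dec ¬? (usesC? (Vec.lookup cs j) x)) ×-dec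
      all? (λ i → all? λ x → usesC? (Vec.lookup cs i) x →-dec (x ∈? ys))

    from-certificates : ∀ ys {k} (cs : Vec Certificate k) → DisjointWithin ys cs → DisjointCopiesWithin G H ys k
    from-certificates ys cs (isCopy , disjoint , within) = (λ i → copy (Vec.lookup cs i) (isCopy i)) , disjoint , within

    to-certificates : ∀ ys k → DisjointCopiesWithin G H ys k →
              ∃[ cs ] All (λ c → All (λ _ → ⊤) (proj₁ c) × Short c) cs × DisjointWithin ys cs
    to-certificates ys k (M , disjoint , within) =
      cs , tabulate⁺ (λ i → universal _ _ , certificate-short (M i)) , isCopy , disjoint' , within'
      where
      cs = Vec.tabulate (certificate ∘ M)
      uses : ∀ i x → UsesC (Vec.lookup cs i) x → Uses (M i) x
      uses i x u = Uses-certificate (M i) x (subst (λ c → UsesC c x) (lookup∘tabulate _ i) u)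
      isCopy : ∀ i → IsCopy (Vec.lookup cs i)
      isCopy i = subst IsCopy (sym (lookup∘tabulate _ i)) (certificate-isCopy (M i))
      disjoint' : ∀ i j → i ≢ j → ∀ x → UsesC (Vec.lookup cs i) x → ¬ UsesC (Vec.lookup cs j) x
      disjoint' i j i≢j x ui uj = disjoint i j i≢j x (uses i x ui) (uses j x uj)
      within' : ∀ i x → UsesC (Vec.lookup cs i) x → x ∈ ys
      within' i x u = within i x (uses i x u)

  disjointCopiesWithin? : ∀ ys k → Dec (DisjointCopiesWithin G H ys k)
  disjointCopiesWithin? ys k =
    map′ (λ (cs , _ , valid) → from-certificates ys cs valid) (to-certificates ys k)
         (search-Vec search-Certificate k (DisjointWithin ys) (disjointWithin? ys))

induced : (G : Digraph) → List (Fin (size G)) → Digraph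
induced G xs = record
  { size = length xs
  ; arc = λ i j → arc G (lookup xs i) (lookup xs j)
  ; loopless = λ i → loopless G (lookup xs i) }

induced-tournament : ∀ G {xs} → Unique xs → IsTournament G → IsTournament (induced G xs)
induced-tournament G {xs} uniq tour i j i≢j =
  tour (lookup xs i) (lookup xs j) λ eq → i≢j (lookup-injective uniq i j eq)

module Lift (G : Digraph) {xs : List (Fin (size G))} (uniq : Unique xs) {P : Digraph} where
  private
    f = lookup xs
    f-inj : ∀ {a b} → f a ≡ f b → a ≡ b
    f-inj = lookup-injective uniq _ _

    walk-map : ∀ a l b → WalkVia (induced G xs) a l b → WalkVia G (f a) (map f l) (f b)
    walk-map a []      b w        = w
    walk-map a (x ∷ l) b (w , ws) = w , walk-map x l b ws

  lift : TMCopy (induced G xs) P → TMCopy G P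
  lift M = record
    { φ = λ w → f (φ M w)
    ; φ-inj = λ u v eq → φ-inj M u v (f-inj eq)
    ; path = λ u v a → map f (path M u v a)
    ; path-walk = λ u v a → walk-map (φ M u) (path M u v a) (φ M v) (path-walk M u v a)
    ; path-unique = λ u v a → Unique.map⁺ f-inj (path-unique M u v a)
    ; path-avoid = λ u v a x x∈ w eq →
        let (y , y∈ , x≡fy) = ∈-map⁻ f x∈ in path-avoid M u v a y y∈ w (f-inj (trans (sym x≡fy) eq))
    ; path-disj = λ u v a u' v' a' x x∈ x∈' →
        let (y , y∈ , x≡fy) = ∈-map⁻ f x∈ ; (y' , y∈' , x≡fy') = ∈-map⁻ f x∈' in
        path-disj M u v a u' v' a' y y∈ (subst (_∈ path M u' v' a') (f-inj (trans (sym x≡fy') x≡fy)) y∈') }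

  Uses-lift : ∀ M x → Uses (lift M) x → x ∈ xs
  Uses-lift M x (inj₁ (w , eq)) = subst (_∈ xs) (sym eq) (∈-lookup (φ M w))
  Uses-lift M x (inj₂ (_ , _ , _ , x∈)) =
    let (y , _ , x≡fy) = ∈-map⁻ f x∈ in subst (_∈ xs) (sym x≡fy) (∈-lookup y)

induced-free-of-· : ∀ G H {xs} → Unique xs → ∀ k →
  ¬ DisjointCopiesWithin G H xs k → ¬ ContainsTM (induced G xs) (k · H)
induced-free-of-· G H uniq k no-copies M =
  let (F , disjoint , uses) = ·-copy⇒disjoint-copies H k (lift M)
  in no-copies (F , disjoint , λ i x u → Uses-lift M x (uses i x u))
  where open Lift G uniq

-- R is closed under the arcs of the copy, so by strong connectivity one branch
-- vertex in R (resp. in L) forces the whole copy into R (resp. into L).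
module OneSide {G H : Digraph} (strong : StronglyConnected H) (M : TMCopy G H)
  (L R : Fin (size G) → Set)
  (L⊎R : ∀ x → Uses M x → L x ⊎ R x)
  (L∩R : ∀ {x} → L x → R x → ⊥)
  (no-R→L : ∀ {x y} → R x → L y → ¬ Arc G x y) where

  private
    arc-R : ∀ {x y} → Uses M y → R x → Arc G x y → R y
    arc-R {y = y} uy rx xy with L⊎R y uy
    ... | inj₁ ly = ⊥-elim (no-R→L rx ly xy)
    ... | inj₂ ry = ry

    walk-R : ∀ a l b → WalkVia G a l b → (∀ z → z ∈ l → Uses M z) → Uses M b →
             R a → R b × (∀ z → z ∈ l → R z)
    walk-R a []      b ab       _  ub ra = arc-R ub ra ab , λ _ ()
    walk-R a (x ∷ l) b (ax , w) ul ub ra =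
      let rx = arc-R (ul x (here refl)) ra ax
          (rb , rl) = walk-R x l b w (λ z z∈ → ul z (there z∈)) ub rx
      in rb , λ { z (here refl) → rx ; z (there z∈) → rl z z∈ }

    walk-R-from : ∀ a l b → WalkVia G a l b → (∀ z → z ∈ l → Uses M z) → Uses M b →
                  ∀ z → z ∈ l → R z → R b
    walk-R-from a (x ∷ l) b (_ , w) ul ub z (here refl) rz =
      proj₁ (walk-R x l b w (λ z z∈ → ul z (there z∈)) ub rz)
    walk-R-from a (x ∷ l) b (_ , w) ul ub z (there z∈) rz =
      walk-R-from x l b w (λ z z∈ → ul z (there z∈)) ub z z∈ rz

    path-walk-R : ∀ u v (a : Arc H u v) → R (φ M u) → R (φ M v) × (∀ z → z ∈ path M u v a → R z)
    path-walk-R u v a = walk-R _ _ _ (path-walk M u v a) (λ z z∈ → inj₂ (u , v , a , z∈)) (inj₁ (v , refl))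

    reach-R : ∀ {u v} → Reach H u v → R (φ M u) → R (φ M v)
    reach-R here             ru = ru
    reach-R (step {u} {w} a rest) ru = reach-R rest (proj₁ (path-walk-R u w a ru))

    all-R : ∀ w → R (φ M w) → ∀ x → Uses M x → R x
    all-R w rw x (inj₁ (v , refl)) = reach-R (strong w v) rw
    all-R w rw x (inj₂ (u , v , a , x∈)) = proj₂ (path-walk-R u v a (reach-R (strong w u) rw)) x x∈

    R⇒R-branch : ∀ w x → Uses M x → R x → R (φ M w)
    R⇒R-branch w x (inj₁ (v , refl)) rx = reach-R (strong v w) rx
    R⇒R-branch w x (inj₂ (u , v , a , x∈)) rx = reach-R (strong v w)
      (walk-R-from _ _ _ (path-walk M u v a) (λ z z∈ → inj₂ (u , v , a , z∈)) (inj₁ (v , refl)) x x∈ rx)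

    all-L : ∀ w → L (φ M w) → ∀ x → Uses M x → L x
    all-L w lw x ux with L⊎R x ux
    ... | inj₁ lx = lx
    ... | inj₂ rx = ⊥-elim (L∩R lw (R⇒R-branch w x ux rx))

  one-side : Fin (size H) → (∀ x → Uses M x → L x) ⊎ (∀ x → Uses M x → R x)
  one-side w with L⊎R (φ M w) (inj₁ (w , refl))
  ... | inj₁ lw = inj₁ (all-L w lw)
  ... | inj₂ rw = inj₂ (all-R w rw)

module Main (dp dq : ℕ)
  (pw-bound : ∀ (H' T' : Digraph) → IsTournament T' → ¬ ContainsTM T' H' →
              PwTimesAtMost T' dq (dp * ‖ H' ‖))
  (H : Digraph) (strong : StronglyConnected H) (x₀ : Fin (size H))
  (T : Digraph) (tour : IsTournament T) where

  private
    n C : ℕ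
    n = size T
    C = dp * ‖ H ‖

  HitsWithin : List (Fin n) → List (Fin n) → Set
  HitsWithin xs S = ∀ (M : TMCopy T H) → (∀ x → Uses M x → x ∈ xs) → ¬ (∀ x → Uses M x → x ∉ S)

  SmallHittingSet : ℕ → List (Fin n) → Set
  SmallHittingSet k xs = Σ (List (Fin n)) λ S → 2 ^ (length S * dq) ≤ Φ k ^ C × HitsWithin xs S

  copies⇒nonempty : ∀ {ys k} → 1 ≤ k → DisjointCopiesWithin T H ys k → ∃[ x ] x ∈ ys
  copies⇒nonempty {k = suc _} _ (F , _ , within) = φ (F zero) x₀ , within zero _ (inj₁ (x₀ , refl))

  module Step {k a b : ℕ} (a+b≡k : a + b ≡ k) (1≤a : 1 ≤ a) (1≤b : 1 ≤ b)
    (split : 2 ^ k * (Φ a * Φ b) ≤ Φ k)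
    {xs : List (Fin n)} (uniq : Unique xs) (no-copies : ¬ DisjointCopiesWithin T H xs k)
    (rec-a : ∀ ys → Unique ys → ¬ DisjointCopiesWithin T H ys a → SmallHittingSet a ys)
    (rec-b : ∀ ys → Unique ys → ¬ DisjointCopiesWithin T H ys b → SmallHittingSet b ys) where

    private
      m : ℕ
      m = length xs
      f : Fin m → Fin n
      f = lookup xs
      f-inj : ∀ {i j} → f i ≡ f j → i ≡ j
      f-inj = lookup-injective uniq _ _

      decomposition : PwTimesAtMost (induced T xs) dq (dp * ‖ k · H ‖)
      decomposition = pw-bound (k · H) (induced T xs) (induced-tournament T uniq tour)
                               (induced-free-of-· T H uniq k no-copies)
      D : IntervalDecomp (induced T xs)
      D = proj₁ decomposition
      lo' hi' : Fin m → ℤ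
      lo' = lo D
      hi' = hi D

      left? : ∀ α → Decidable (λ i → hi' i ℤ.< α)
      left? α i = hi' i ℤ.<? α
      right? : ∀ α → Decidable (λ i → α ℤ.< lo' i)
      right? α i = α ℤ.<? lo' i
      bag? : ∀ α → Decidable (λ i → lo' i ℤ.≤ α × α ℤ.≤ hi' i)
      bag? α i = (lo' i ℤ.≤? α) ×-dec (α ℤ.≤? hi' i)

    Left Right Bag : ℤ → List (Fin n)
    Left  α = map f (filter (left? α) (allFin m))
    Right α = map f (filter (right? α) (allFin m))
    Bag   α = map f (filter (bag? α) (allFin m))

    unique-Left : ∀ α → Unique (Left α)
    unique-Left α = Unique.map⁺ f-inj (Unique.filter⁺ (left? α) (Unique.allFin⁺ m))

    unique-Right : ∀ α → Unique (Right α)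
    unique-Right α = Unique.map⁺ f-inj (Unique.filter⁺ (right? α) (Unique.allFin⁺ m))

    length-Bag : ∀ α → length (Bag α) * dq ≤ k * C
    length-Bag α = begin
      length (Bag α) * dq   ≡⟨ cong (_* dq) (length-map f (filter (bag? α) (allFin m))) ⟩
      bagSize D α * dq      ≤⟨ proj₂ decomposition α ⟩
      dp * ‖ k · H ‖        ≡⟨ cong (dp *_) (‖·‖ k H) ⟩
      dp * (k * ‖ H ‖)      ≡⟨ solve 3 (λ d k h → d :* (k :* h) := k :* (d :* h)) refl dp k ‖ H ‖ ⟩
      k * C                 ∎
      where open ≤-Reasoning
            open +-*-Solver

    ⊆-xs : ∀ {P : Fin m → Set} (P? : Decidable P) → map f (filter P? (allFin m)) ⊆ xs
    ⊆-xs P? x∈ with ∈-map-filter⁻ f P? x∈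
    ... | i , refl , _ = ∈-lookup i

    not-left-and-right : ∀ {α β x} → β ℤ.≤ sucℤ α → x ∈ Left β → x ∈ Right α → ⊥
    not-left-and-right {α} β≤α+1 x∈L x∈R with ∈-map-filter⁻ f (left? _) x∈L | ∈-map-filter⁻ f (right? α) x∈R
    ... | i , x≡fi , hi<β | j , x≡fj , α<lo with f-inj (trans (sym x≡fi) x≡fj)
    ... | refl = ℤ.<-irrefl refl (ℤ.≤-<-trans hi≤α (ℤ.<-≤-trans α<lo (lo≤hi D i)))
      where
      hi≤α : hi' i ℤ.≤ α
      hi≤α = subst (hi' i ℤ.≤_) (ℤ.pred-suc α) (ℤ.i<j⇒i≤pred[j] (ℤ.<-≤-trans hi<β β≤α+1))

    outside-bag : ∀ α i → f i ∉ Bag α → f i ∈ Left α ⊎ f i ∈ Right α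
    outside-bag α i ∉bag with bag? α i | left? α i
    ... | yes in-bag | _ = ⊥-elim (∉bag (∈-map-filter⁺ f (bag? α) in-bag))
    ... | no _ | yes left = inj₁ (∈-map-filter⁺ f (left? α) left)
    ... | no not-in-bag | no not-left =
      inj₂ (∈-map-filter⁺ f (right? α) (ℤ.≰⇒> λ lo≤α → not-in-bag (lo≤α , ℤ.≮⇒≥ not-left)))

    private
      B : ℕ
      B = proj₁ (∣∣-bound lo')

      -- Sweeping α from -B to B passes every interval, since |lo v| ≤ B.
      θ : ℕ → ℤ
      θ i = - (+ B) ℤ.+ + i

      θ-suc : ∀ i → θ (suc i) ≡ sucℤ (θ i)
      θ-suc i = solve 2 (λ b i → :- b :+ (con ℤ.1ℤ :+ i) := con ℤ.1ℤ :+ (:- b :+ i)) refl (+ B) (+ i)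
        where open ℤ-Solver.+-*-Solver

      θ-end : θ (B + B) ≡ + B
      θ-end = solve 1 (λ b → :- b :+ (b :+ b) := b) refl (+ B)
        where open ℤ-Solver.+-*-Solver

      -B≤lo : ∀ i → - (+ B) ℤ.≤ lo' i
      -B≤lo i = ℤ.≤-trans (ℤ.neg-mono-≤ (ℤ.+≤+ (proj₂ (∣∣-bound lo') i))) (-+∣i∣≤i (lo' i))

      lo≤B : ∀ i → lo' i ℤ.≤ + B
      lo≤B i = ℤ.≤-trans (i≤+∣i∣ (lo' i)) (ℤ.+≤+ (proj₂ (∣∣-bound lo') i))

      no-copies-left-of-start : ¬ DisjointCopiesWithin T H (Left (θ 0)) a
      no-copies-left-of-start L-copies with copies⇒nonempty 1≤a L-copies
      ... | x , x∈ with ∈-map-filter⁻ f (left? (θ 0)) x∈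
      ... | i , _ , hi<θ0 = ℤ.<-irrefl refl (ℤ.<-≤-trans hi<θ0
            (ℤ.≤-trans (ℤ.≤-reflexive (ℤ.+-identityʳ _)) (ℤ.≤-trans (-B≤lo i) (lo≤hi D i))))

      no-copies-right-of-end : ¬ DisjointCopiesWithin T H (Right (θ (B + B))) b
      no-copies-right-of-end R-copies with copies⇒nonempty 1≤b R-copies
      ... | x , x∈ with ∈-map-filter⁻ f (right? (θ (B + B))) x∈
      ... | i , _ , end<lo = ℤ.<-irrefl θ-end (ℤ.<-≤-trans end<lo (lo≤B i))

      right-copies⇒no-left-copies : ∀ i → DisjointCopiesWithin T H (Right (θ i)) b →
                                    ¬ DisjointCopiesWithin T H (Left (θ (suc i))) a
      right-copies⇒no-left-copies i R-copies L-copies = no-copies (subst (DisjointCopiesWithin T H xs) a+b≡k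
        (disjoint-copies-++ (not-left-and-right (ℤ.≤-reflexive (θ-suc i))) (⊆-xs _) (⊆-xs _) L-copies R-copies))

    threshold : ∃[ α ] ¬ DisjointCopiesWithin T H (Left α) a × ¬ DisjointCopiesWithin T H (Right α) b
    threshold with sweep (λ i → DecideCopies.disjointCopiesWithin? T H (Right (θ i)) b)
                         right-copies⇒no-left-copies (B + B) no-copies-left-of-start no-copies-right-of-end
    ... | i , no-left , no-right = θ i , no-left , no-right

    module Separated (α : ℤ) (no-left : ¬ DisjointCopiesWithin T H (Left α) a)
                     (no-right : ¬ DisjointCopiesWithin T H (Right α) b) where
      private
        hitting-Left : SmallHittingSet a (Left α)
        hitting-Left = rec-a (Left α) (unique-Left α) no-left
        hitting-Right : SmallHittingSet b (Right α)
        hitting-Right = rec-b (Right α) (unique-Right α) no-right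
        S-L S-R S : List (Fin n)
        S-L = proj₁ hitting-Left
        S-R = proj₁ hitting-Right
        S = Bag α ++ (S-L ++ S-R)

        small : 2 ^ (length S * dq) ≤ Φ k ^ C
        small = subst (λ l → 2 ^ (l * dq) ≤ Φ k ^ C)
          (sym (trans (length-++ (Bag α)) (cong (λ l → length (Bag α) + l) (length-++ S-L))))
          (combine-bounds C dq {k} {a} {b} (length (Bag α)) (length S-L) (length S-R) (length-Bag α)
                          (proj₁ (proj₂ hitting-Left)) (proj₁ (proj₂ hitting-Right)) split)

        no-arc-right-to-left : ∀ {x y} → x ∈ Right α → y ∈ Left α → ¬ Arc T x y
        no-arc-right-to-left x∈R y∈L xy
          with ∈-map-filter⁻ f (right? α) x∈R | ∈-map-filter⁻ f (left? α) y∈L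
        ... | i , refl , α<lo | j , refl , hi<α
          with tour (f i) (f j) (λ eq → not-left-and-right (ℤ.i≤suc[i] α) (subst (_∈ Left α) (sym eq) y∈L) x∈R)
        ... | inj₁ (_ , ¬yx) = ¬yx (ordered D j i (ℤ.<-trans hi<α α<lo))
        ... | inj₂ (_ , ¬xy) = ¬xy xy

        module _ (M : TMCopy T H) (within : ∀ x → Uses M x → x ∈ xs)
                 (avoids : ∀ x → Uses M x → x ∉ S) where
          left-or-right : ∀ x → Uses M x → x ∈ Left α ⊎ x ∈ Right α
          left-or-right x ux =
            let x∈xs = within x ux ; x≡f[i] = lookup-index x∈xs in
            subst (λ y → y ∈ Left α ⊎ y ∈ Right α) (sym x≡f[i])
              (outside-bag α (index x∈xs) λ f[i]∈ → avoids x ux (∈-++⁺ˡ (subst (_∈ Bag α) (sym x≡f[i]) f[i]∈)))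

          open OneSide strong M (_∈ Left α) (_∈ Right α) left-or-right
                       (not-left-and-right (ℤ.i≤suc[i] α)) no-arc-right-to-left

          hits : ⊥
          hits with one-side x₀
          ... | inj₁ all-left = proj₂ (proj₂ hitting-Left) M all-left
                  λ x ux x∈ → avoids x ux (∈-++⁺ʳ (Bag α) (∈-++⁺ˡ x∈))
          ... | inj₂ all-right = proj₂ (proj₂ hitting-Right) M all-right
                  λ x ux x∈ → avoids x ux (∈-++⁺ʳ (Bag α) (∈-++⁺ʳ S-L x∈))

      hitting-set : SmallHittingSet k xs
      hitting-set = S , small , hits

    hitting-set : SmallHittingSet k xs
    hitting-set = Separated.hitting-set (proj₁ threshold) (proj₁ (proj₂ threshold)) (proj₂ (proj₂ threshold))

  hitting-set : ∀ k → 1 ≤ k → ∀ xs → Unique xs → ¬ DisjointCopiesWithin T H xs k → SmallHittingSet k xs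
  hitting-set = <-rec _ go
    where
    go : ∀ k → (∀ {j} → j < k → 1 ≤ j → ∀ xs → Unique xs → ¬ DisjointCopiesWithin T H xs j →
                SmallHittingSet j xs) →
         1 ≤ k → ∀ xs → Unique xs → ¬ DisjointCopiesWithin T H xs k → SmallHittingSet k xs
    go (suc zero) _ _ xs _ no-copies = [] , ≤-reflexive (sym (^-zeroˡ C)) , λ M within _ →
      no-copies ((λ _ → M) , (λ { zero zero 0≢0 → ⊥-elim (0≢0 refl) }) , λ _ → within)
    go k@(suc (suc _)) rec _ xs uniq no-copies with balanced-split k (s≤s (s≤s z≤n))
    ... | a , b , 1≤a , 1≤b , a+b≡k , split =
      Step.hitting-set a+b≡k 1≤a 1≤b split uniq no-copies
        (rec (subst (a <_) a+b≡k (m<m+n a 1≤b)) 1≤a)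
        (rec (subst (b <_) a+b≡k (m<n+m b 1≤a)) 1≤b)

vertex-or-empty : ∀ n → Fin n ⊎ ¬ Fin n
vertex-or-empty zero    = inj₂ λ ()
vertex-or-empty (suc n) = inj₁ zero

vertexless-copies : ∀ {G H} → ¬ Fin (size H) → ∀ k → DisjointCopies G H k
vertexless-copies {G} {H} no-vertex k = (λ _ → empty-copy) , λ _ _ _ x u → ⊥-elim (unused x u)
  where
  empty-copy : TMCopy G H
  empty-copy = record
    { φ = λ w → ⊥-elim (no-vertex w) ; φ-inj = λ u → ⊥-elim (no-vertex u)
    ; path = λ u → ⊥-elim (no-vertex u) ; path-walk = λ u → ⊥-elim (no-vertex u)
    ; path-unique = λ u → ⊥-elim (no-vertex u) ; path-avoid = λ u → ⊥-elim (no-vertex u)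
    ; path-disj = λ u → ⊥-elim (no-vertex u) }
  unused : ∀ x → Uses empty-copy x → ⊥
  unused x (inj₁ (w , _)) = no-vertex w
  unused x (inj₂ (u , _)) = no-vertex u

Φ^C : ∀ k dp N → Φ k ^ (dp * N) ≡ k ^ (2 * dp * N * k)
Φ^C k dp N = trans (^-*-assoc k (2 * k) (dp * N))
  (cong (k ^_) (solve 3 (λ k d n → con 2 :* k :* (d :* n) := con 2 :* d :* n :* k) refl k dp N))
  where open +-*-Solver

lemma21 : (dp dq : ℕ) → 1 ≤ dq →
    (∀ (H' T' : Digraph) → IsTournament T' → ¬ ContainsTM T' H' →
      PwTimesAtMost T' dq (dp * ‖ H' ‖)) →
    (H : Digraph) → StronglyConnected H →
    (k : ℕ) → 1 ≤ k →
    (T : Digraph) → IsTournament T → ¬ DisjointCopies T H k →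
    Σ (Subset (size T)) λ S →
      (2 ^ (∣ S ∣ * dq) ≤ k ^ (2 * dp * ‖ H ‖ * k)) × IsHitting T H S
lemma21 dp dq _ pw-bound H strong k 1≤k T tour no-copies with vertex-or-empty (size H)
... | inj₂ no-vertex = ⊥-elim (no-copies (vertexless-copies no-vertex k))
... | inj₁ x₀ with Main.hitting-set dp dq pw-bound H strong x₀ T tour k 1≤k
                      (allFin (size T)) (Unique.allFin⁺ (size T))
                      (λ (F , disjoint , _) → no-copies (F , disjoint))
...   | S , small , hits = fromList S , small' , hitting
  where
  small' : 2 ^ (∣ fromList S ∣ * dq) ≤ k ^ (2 * dp * ‖ H ‖ * k)
  small' = ≤-trans (^-monoʳ-≤ 2 (*-monoˡ-≤ dq (∣fromList∣≤length S)))
                   (subst (2 ^ (length S * dq) ≤_) (Φ^C k dp ‖ H ‖) small)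
  hitting : IsHitting T H (fromList S)
  hitting (M , avoids) = hits M (λ x _ → ∈-allFin x) λ x u x∈ → avoids x u (∈-fromList x∈)
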